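{- Let $m\geq 1$ be an integer and, for each integer $s\geq 1$, let $E^+_m(s)$ denote the number of partitions with distinct parts that are simultaneously $s$-cores and $(ms+1)$-cores. Then $E^+_m(1)=1$, $E^+_m(2)=m+1$, and for every $s\geq 3$, $$E^+_m(s)=E^+_m(s-1)+m\,E^+_m(s-2).$$
   Context: A partition has distinct parts if no part is repeated. For a box $(i,j)$ of the Young diagram of a partition $\lambda$, its hook length is the number of boxes in the same row weakly to its right plus the number of boxes in the same column strictly below it. A partition is an $s$-core if none of its hook lengths equals $s$; it is an $(s,t)$-core if it is both an $s$-core and a $t$-core. The empty partition counts as a core. -}

module Defs where

open import Data.Nat using (ℕ; zero; suc; _+_; _∸_; _<_; _≥_; _<?_)
open import Data.List using (List; []; _∷_; length; filter)
open import Data.List.Relation.Unary.All using (All)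
open import Data.List.Relation.Unary.Linked using (Linked)
open import Data.List.Relation.Unary.Unique.Propositional using (Unique)
open import Data.List.Membership.Propositional using (_∈_)
open import Data.Product using (Σ; ∃; _×_)
open import Function.Bundles using (_⇔_)
open import Relation.Binary.PropositionalEquality using (_≡_)
open import Relation.Nullary using (¬_)

IsPartition : List ℕ → Set
IsPartition λ′ = All (0 <_) λ′ × Linked _≥_ λ′

DistinctParts : List ℕ → Set
DistinctParts λ′ = Unique λ′

-- i-th part (0-indexed), 0 beyond the length.
part : List ℕ → ℕ → ℕ
part []       _       = 0
part (p ∷ _)  zero    = p
part (_ ∷ ps) (suc i) = part ps i

colLen : List ℕ → ℕ → ℕ
colLen λ′ j = length (filter (j <?_) λ′)

-- Hook length of box (i,j) (0-indexed): boxes weakly right in row i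
-- plus boxes strictly below in column j.
hook : List ℕ → ℕ → ℕ → ℕ
hook λ′ i j = (part λ′ i ∸ j) + (colLen λ′ j ∸ suc i)

HasHook : List ℕ → ℕ → Set
HasHook λ′ h = ∃ λ i → ∃ λ j → i < length λ′ × j < part λ′ i × hook λ′ i j ≡ h

IsCore : ℕ → List ℕ → Set
IsCore s λ′ = ¬ HasHook λ′ s

DistinctCore : ℕ → ℕ → List ℕ → Set
DistinctCore m s λ′ =
  IsPartition λ′ × DistinctParts λ′ × IsCore s λ′ × IsCore (m Data.Nat.* s + 1) λ′

Counts : (List ℕ → Set) → ℕ → Set
Counts P n = Σ (List (List ℕ)) λ L → Unique L × (∀ μ → (μ ∈ L) ⇔ P μ) × length L ≡ n

module Submission where

-- A partition with distinct parts is a strictly decreasing list λ₀ > ⋯ > λ_{ℓ-1} > 0.  Its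
-- β-set β(λ) = {λ_i + (ℓ-1-i)} is "sparse" (positive, no two members consecutive), and every
-- sparse set comes from exactly one such λ.  The hook lemma says the hook lengths of λ are the
-- differences x - d with x ∈ β(λ), d ∉ β(λ); so λ is a t-core iff β(λ) is closed under x ↦ x - t.
-- For s = k + 1 put x = r + q·s on runner r, level q of an abacus.  A sparse set closed under
-- -s and -(ms+1) avoids runner 0, fills on runner r = 1, …, k the lowest c_r ≤ m levels, and
-- never uses two neighbouring runners.  So the (s, ms+1)-cores with distinct parts correspond to
-- words c₁ ⋯ c_k with entries ≤ m and no two adjacent nonzero entries, which are listed
-- explicitly by their first entry; this gives E(k+1) = E(k) + m·E(k-1).

open import Defs
open import Data.Nat
open import Data.Nat.Properties
open import Data.Nat.DivMod using (m≡m%n+[m/n]*n; m%n<n)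
open import Data.Nat.Tactic.RingSolver using (solve-∀)
open import Data.List using (List; []; _∷_; length; filter; map; _++_; upTo; downFrom; applyUpTo; cartesianProductWith)
open import Data.List.Properties using (filter-accept; filter-none; length-map; length-++; length-upTo; length-applyUpTo)
open import Data.List.Relation.Unary.All as All using (All; []; _∷_)
import Data.List.Relation.Unary.All.Properties as All
open import Data.List.Relation.Unary.Any using (here; there)
open import Data.List.Relation.Unary.AllPairs as AllPairs using ([]; _∷_)
open import Data.List.Relation.Unary.Linked as Linked using (Linked; []; [-]; _∷_)
import Data.List.Relation.Unary.Linked.Properties as Linked
open import Data.List.Relation.Unary.Unique.Propositional using (Unique)
import Data.List.Relation.Unary.Unique.Propositional.Properties as Unique
open import Data.List.Relation.Unary.Sorted.TotalOrder.Properties using (↗↭↗⇒≋)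
open import Data.List.Relation.Binary.Pointwise using (Pointwise-≡⇒≡)
open import Data.List.Relation.Binary.BagAndSetEquality using (∼bag⇒↭)
open import Data.List.Relation.Binary.Permutation.Propositional using (_↭_; ↭⇒↭ₛ)
open import Data.List.Relation.Binary.Permutation.Propositional.Properties using (↭-length)
open import Data.List.Membership.Propositional using (_∈_; _∉_)
open import Data.List.Membership.Propositional.Properties
open import Data.List.Membership.Propositional.Properties.WithK using (unique∧set⇒bag)
open import Data.List.Membership.DecPropositional _≟_ using (_∈?_)
open import Data.Product using (∃-syntax; _×_; _,_; proj₁; proj₂)
open import Data.Sum using (_⊎_; inj₁; inj₂)
open import Data.Empty using (⊥; ⊥-elim)
open import Function using (_∘_)
open import Function.Bundles using (_⇔_; mk⇔; Equivalence)
open import Function.Properties.Equivalence using () renaming (trans to ⇔-trans; sym to ⇔-sym)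
open import Level using (0ℓ)
open import Relation.Binary.Bundles using (TotalOrder)
open import Relation.Binary.Definitions using (Transitive; tri<; tri≈; tri>)
open import Relation.Binary.PropositionalEquality
open import Relation.Nullary using (Dec; yes; no; ¬_; ¬?)
open import Relation.Nullary.Decidable using (_×-dec_)

unique-set⇒↭ : ∀ {A : Set} {xs ys : List A} → Unique xs → Unique ys →
               (∀ {x} → (x ∈ xs) ⇔ (x ∈ ys)) → xs ↭ ys
unique-set⇒↭ uxs uys same = ∼bag⇒↭ (unique∧set⇒bag uxs uys same)

counts-unique : ∀ {P : List ℕ → Set} {a b} → Counts P a → Counts P b → a ≡ b
counts-unique (L , uL , memL , refl) (M , uM , memM , refl) =
  ↭-length (unique-set⇒↭ uL uM (λ {μ} → ⇔-trans (memL μ) (⇔-sym (memM μ))))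

map-unique : ∀ {A B : Set} (f : A → B) {xs : List A} → Unique xs →
             (∀ {x y} → x ∈ xs → y ∈ xs → f x ≡ f y → x ≡ y) → Unique (map f xs)
map-unique f {[]} _ _ = []
map-unique f {x ∷ xs} (x∉xs ∷ uxs) inj = fresh ∷ map-unique f uxs (λ p q → inj (there p) (there q))
  where
  fresh : All (f x ≢_) (map f xs)
  fresh = All.map⁺ (All.tabulate λ y∈xs fx≡fy → All.lookup x∉xs y∈xs (inj (here refl) (there y∈xs) fx≡fy))

Strict : List ℕ → Set
Strict l = All (0 <_) l × Linked _>_ l

>-trans : Transitive _>_
>-trans a>b b>c = <-trans b>c a>b

head-relates : ∀ {R : ℕ → ℕ → Set} → Transitive R → ∀ {p l} → Linked R (p ∷ l) → All (R p) l
head-relates trans [-] = []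
head-relates trans (r ∷ rs) = Linked.Linked⇒All trans r rs

strict-tail : ∀ {p l} → Strict (p ∷ l) → Strict l
strict-tail (_ ∷ pos , lk) = pos , Linked.tail lk

strict-below : ∀ {p l} → Strict (p ∷ l) → All (_≤ p) l
strict-below (_ , lk) = All.map <⇒≤ (head-relates >-trans lk)

parts-≤ : ∀ {q l j} → Strict (q ∷ l) → q ≤ j → All (_≤ j) (q ∷ l)
parts-≤ sp q≤j = q≤j ∷ All.map (λ r≤q → ≤-trans r≤q q≤j) (strict-below sp)

strict-unique : ∀ {l} → Linked _>_ l → Unique l
strict-unique lk = AllPairs.map (λ a>b a≡b → <⇒≢ a>b (sym a≡b)) (Linked.Linked⇒AllPairs >-trans lk)

distinct⇒strict : ∀ {l} → IsPartition l → DistinctParts l → Strict l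
distinct⇒strict (pos , lk) u = pos , decreasing lk u
  where
  decreasing : ∀ {l} → Linked _≥_ l → Unique l → Linked _>_ l
  decreasing [] _ = []
  decreasing [-] _ = [-]
  decreasing (ge ∷ lk) ((ne ∷ _) ∷ u) = ≤∧≢⇒< ge (ne ∘ sym) ∷ decreasing lk u

strict⇒distinct : ∀ {l} → Strict l → IsPartition l × DistinctParts l
strict⇒distinct (pos , lk) = (pos , Linked.map <⇒≤ lk) , strict-unique lk

-- ℕ ordered by ≥: the sorted lists for this order are the weakly decreasing ones.
≥-totalOrder : TotalOrder 0ℓ 0ℓ 0ℓ
≥-totalOrder = record
  { Carrier = ℕ ; _≈_ = _≡_ ; _≤_ = _≥_
  ; isTotalOrder = record
    { isPartialOrder = record
      { isPreorder = record
        { isEquivalence = isEquivalence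
        ; reflexive = λ { refl → ≤-refl }
        ; trans = λ a≥b b≥c → ≤-trans b≥c a≥b }
      ; antisym = λ a≥b b≥a → ≤-antisym b≥a a≥b }
    ; total = λ a b → ≤-total b a } }

strict-ext : ∀ {xs ys} → Linked _>_ xs → Linked _>_ ys → (∀ {z} → (z ∈ xs) ⇔ (z ∈ ys)) → xs ≡ ys
strict-ext xs↘ ys↘ same = Pointwise-≡⇒≡ (↗↭↗⇒≋ ≥-totalOrder (Linked.map <⇒≤ xs↘) (Linked.map <⇒≤ ys↘)
  (↭⇒↭ₛ (unique-set⇒↭ (strict-unique xs↘) (strict-unique ys↘) same)))

-- The β-set of a partition (first-column hook lengths) and its inverse on sparse lists.
β : List ℕ → List ℕ
β [] = []
β (p ∷ l) = p + length l ∷ β l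

β⁻¹ : List ℕ → List ℕ
β⁻¹ [] = []
β⁻¹ (x ∷ X) = x ∸ length X ∷ β⁻¹ X

_≫_ : ℕ → ℕ → Set
a ≫ b = suc b < a

≫-trans : Transitive _≫_
≫-trans a≫b b≫c = <-trans b≫c (<-trans (n<1+n _) a≫b)

Sparse : List ℕ → Set
Sparse X = All (0 <_) X × Linked _≫_ X

NonConsecutive : List ℕ → Set
NonConsecutive X = ∀ {a} → a ∈ X → suc a ∈ X → ⊥

sparse-tail : ∀ {x X} → Sparse (x ∷ X) → Sparse X
sparse-tail (_ ∷ pos , lk) = pos , Linked.tail lk

decreasing⇒sparse : ∀ {X} → All (0 <_) X → Linked _>_ X → NonConsecutive X → Sparse X
decreasing⇒sparse pos lk nc = pos , gaps lk nc
  where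
  gaps : ∀ {X} → Linked _>_ X → NonConsecutive X → Linked _≫_ X
  gaps [] _ = []
  gaps [-] _ = [-]
  gaps (x>y ∷ lk) nc = ≤∧≢⇒< x>y (λ sy≡x → nc (there (here refl)) (here sy≡x))
                       ∷ gaps lk (λ a∈ sa∈ → nc (there a∈) (there sa∈))

gapped⇒nonConsecutive : ∀ {X} → Linked _≫_ X → NonConsecutive X
gapped⇒nonConsecutive {[]} _ ()
gapped⇒nonConsecutive {x ∷ X} lk = go
  where
  below : All (x ≫_) X
  below = head-relates ≫-trans lk
  go : ∀ {a} → a ∈ x ∷ X → suc a ∈ x ∷ X → ⊥
  go (here refl) (here sa≡a) = 1+n≢n sa≡a
  go (here refl) (there sa∈) = <-asym (All.lookup below sa∈) (<-trans (n<1+n _) (n<1+n _))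
  go (there a∈) (here refl) = <-irrefl refl (All.lookup below a∈)
  go (there a∈) (there sa∈) = gapped⇒nonConsecutive (Linked.tail lk) a∈ sa∈

length-β : ∀ l → length (β l) ≡ length l
length-β [] = refl
length-β (p ∷ l) = cong suc (length-β l)

length-β⁻¹ : ∀ X → length (β⁻¹ X) ≡ length X
length-β⁻¹ [] = refl
length-β⁻¹ (x ∷ X) = cong suc (length-β⁻¹ X)

β⁻¹-β : ∀ l → β⁻¹ (β l) ≡ l
β⁻¹-β [] = refl
β⁻¹-β (p ∷ l) = cong₂ _∷_ (trans (cong (p + length l ∸_) (length-β l)) (m+n∸n≡m p (length l))) (β⁻¹-β l)

β-bounded : ∀ {j} l → All (_≤ j) l → All (_< j + length l) (β l)
β-bounded [] [] = []
β-bounded {j} (q ∷ l) (q≤j ∷ l≤j) = head ∷ All.map (λ x< → <-trans x< (+-monoʳ-< j (n<1+n _))) (β-bounded l l≤j)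
  where
  head : q + length l < j + suc (length l)
  head rewrite +-suc j (length l) = s≤s (+-monoˡ-≤ (length l) q≤j)

β-sparse : ∀ {l} → Strict l → Sparse (β l)
β-sparse (pos , lk) = positive pos , gaps lk
  where
  positive : ∀ {l} → All (0 <_) l → All (0 <_) (β l)
  positive [] = []
  positive {p ∷ l} (p>0 ∷ pos) = ≤-trans p>0 (m≤m+n p (length l)) ∷ positive pos
  gaps : ∀ {l} → Linked _>_ l → Linked _≫_ (β l)
  gaps [] = []
  gaps [-] = [-]
  gaps {p ∷ q ∷ l} (q<p ∷ lk) = gap ∷ gaps lk
    where
    gap : suc (q + length l) < p + suc (length l)
    gap rewrite +-suc p (length l) = s≤s (+-monoˡ-< (length l) q<p)

sparse-head : ∀ {x X} → Sparse (x ∷ X) → length X < x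
sparse-head (x>0 ∷ [] , _) = x>0
sparse-head sp@(_ , x≫y ∷ _) = <-≤-trans (s≤s (sparse-head (sparse-tail sp))) (<⇒≤ x≫y)

-- (The remaining inverse laws use that the head of a sparse list exceeds its length.)
β-β⁻¹ : ∀ {X} → Sparse X → β (β⁻¹ X) ≡ X
β-β⁻¹ {[]} _ = refl
β-β⁻¹ {x ∷ X} sp = cong₂ _∷_ head (β-β⁻¹ (sparse-tail sp))
  where
  head : x ∸ length X + length (β⁻¹ X) ≡ x
  head rewrite length-β⁻¹ X = m∸n+n≡m (<⇒≤ (sparse-head sp))

β⁻¹-strict : ∀ {X} → Sparse X → Strict (β⁻¹ X)
β⁻¹-strict {[]} _ = [] , []
β⁻¹-strict {x ∷ []} (x>0 ∷ [] , _) = x>0 ∷ [] , [-]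
β⁻¹-strict {x ∷ y ∷ Y} sp@(_ , x≫y ∷ _) with β⁻¹-strict (sparse-tail sp)
... | pos , lk = m<n⇒0<n∸m (sparse-head sp) ∷ pos
               , ∸-monoˡ-< x≫y (s≤s (<⇒≤ (sparse-head (sparse-tail sp)))) ∷ lk

∉-above : ∀ {d X} → All (_< d) X → d ∉ X
∉-above below d∈X = <-irrefl refl (All.lookup below d∈X)

∉-∷ : ∀ {d y : ℕ} {X} → d ≢ y → d ∉ X → d ∉ (y ∷ X)
∉-∷ d≢y _ (here d≡y) = d≢y d≡y
∉-∷ _ d∉X (there d∈X) = d∉X d∈X

below-by : ∀ {t d x} → 0 < t → t + d ≡ x → d < x
below-by {d = d} t>0 t+d≡x = <-≤-trans (m<n+m d t>0) (≤-reflexive t+d≡x)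

colLen-∷ : ∀ {j p} l → j < p → colLen (p ∷ l) j ≡ suc (colLen l j)
colLen-∷ {j} l j<p = cong length (filter-accept (j <?_) j<p)

colLen-empty : ∀ {j l} → All (_≤ j) l → colLen l j ≡ 0
colLen-empty {j} l≤j = cong length (filter-none (j <?_) (All.map (λ p≤j j<p → <⇒≱ j<p p≤j) l≤j))

part-All : ∀ {P : ℕ → Set} {l i} → All P l → i < length l → P (part l i)
part-All {i = zero} (Pp ∷ _) _ = Pp
part-All {i = suc i} (_ ∷ Pl) (s≤s i<ℓ) = part-All Pl i<ℓ

hook-first : ∀ {j p} l → j < p → hook (p ∷ l) 0 j ≡ (p ∸ j) + colLen l j
hook-first {j} {p} l j<p = cong (λ c → (p ∸ j) + (c ∸ 1)) (colLen-∷ l j<p)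

hook-later : ∀ {i j p} l → j < p → hook (p ∷ l) (suc i) j ≡ hook l i j
hook-later {i} {j} l j<p = cong (λ c → (part l i ∸ j) + (c ∸ suc (suc i))) (colLen-∷ l j<p)

FirstRowHook : ℕ → List ℕ → ℕ → Set
FirstRowHook p l t = ∃[ j ] j < p × (p ∸ j) + colLen l j ≡ t

hook-∷⇔ : ∀ {p l t} → All (_≤ p) l → HasHook (p ∷ l) t ⇔ (HasHook l t ⊎ FirstRowHook p l t)
hook-∷⇔ {p} {l} {t} l≤p = mk⇔ split join
  where
  column-inside : ∀ {i j} → i < length l → j < part l i → j < p
  column-inside i<ℓ j<part = <-≤-trans j<part (part-All l≤p i<ℓ)
  split : HasHook (p ∷ l) t → HasHook l t ⊎ FirstRowHook p l t
  split (zero , j , _ , j<p , h≡t) = inj₂ (j , j<p , trans (sym (hook-first l j<p)) h≡t)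
  split (suc i , j , s≤s i<ℓ , j<part , h≡t) =
    inj₁ (i , j , i<ℓ , j<part , trans (sym (hook-later l (column-inside i<ℓ j<part))) h≡t)
  join : HasHook l t ⊎ FirstRowHook p l t → HasHook (p ∷ l) t
  join (inj₂ (j , j<p , h≡t)) = zero , j , s≤s z≤n , j<p , trans (hook-first l j<p) h≡t
  join (inj₁ (i , j , i<ℓ , j<part , h≡t)) =
    suc i , j , s≤s i<ℓ , j<part , trans (hook-later l (column-inside i<ℓ j<part)) h≡t

-- The first-row hook lengths t of p ∷ l, read off the β-set: t + d = p + ℓ(l) for a gap d of β(l).
FirstRowGap : ℕ → List ℕ → ℕ → Set
FirstRowGap p l t = 0 < t × ∃[ d ] t + d ≡ p + length l × d ∉ β l

-- Arithmetic of putting a row p above a row q: the first-row hook at column j ≤ q grows by p - q + 1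
-- while the gap d it corresponds to stays.
shift-row : ∀ {j p q} c d L → j ≤ q → j ≤ p → (q ∸ j) + c + d ≡ q + L → (p ∸ j) + suc c + d ≡ p + suc L
shift-row {j} {p} {q} c d L j≤q j≤p e = begin
  (p ∸ j) + suc c + d     ≡⟨ +-assoc (p ∸ j) (suc c) d ⟩
  (p ∸ j) + suc (c + d)   ≡⟨ cong (λ z → (p ∸ j) + suc z) c+d≡j+L ⟩
  (p ∸ j) + suc (j + L)   ≡⟨ cong ((p ∸ j) +_) (sym (+-suc j L)) ⟩
  (p ∸ j) + (j + suc L)   ≡⟨ sym (+-assoc (p ∸ j) j (suc L)) ⟩
  (p ∸ j) + j + suc L     ≡⟨ cong (_+ suc L) (m∸n+n≡m j≤p) ⟩
  p + suc L               ∎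
  where
  open ≡-Reasoning
  c+d≡j+L : c + d ≡ j + L
  c+d≡j+L = +-cancelˡ-≡ (q ∸ j) _ _ (begin
    (q ∸ j) + (c + d)   ≡⟨ sym (+-assoc (q ∸ j) c d) ⟩
    (q ∸ j) + c + d     ≡⟨ e ⟩
    q + L               ≡⟨ cong (_+ L) (sym (m∸n+n≡m j≤q)) ⟩
    (q ∸ j) + j + L     ≡⟨ +-assoc (q ∸ j) j L ⟩
    (q ∸ j) + (j + L)   ∎)

firstRowGap-beyond : ∀ {p j t} l → j < p → All (_≤ j) l → (p ∸ j) + colLen l j ≡ t → FirstRowGap p l t
firstRowGap-beyond {p} {j} {t} l j<p l≤j h≡t = t>0 , j + length l , sum , ∉-above (β-bounded l l≤j)
  where
  open ≡-Reasoning
  p∸j≡t : p ∸ j ≡ t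
  p∸j≡t = trans (sym (+-identityʳ _)) (trans (cong ((p ∸ j) +_) (sym (colLen-empty l≤j))) h≡t)
  t>0 : 0 < t
  t>0 = subst (0 <_) p∸j≡t (m<n⇒0<n∸m j<p)
  sum : t + (j + length l) ≡ p + length l
  sum = begin
    t + (j + length l)        ≡⟨ cong (_+ (j + length l)) (sym p∸j≡t) ⟩
    (p ∸ j) + (j + length l)  ≡⟨ sym (+-assoc (p ∸ j) j (length l)) ⟩
    (p ∸ j) + j + length l    ≡⟨ cong (_+ length l) (m∸n+n≡m (<⇒≤ j<p)) ⟩
    p + length l              ∎

firstRowHook-beyond : ∀ {p j t} l → All (_≤ j) l → 0 < t → t + (j + length l) ≡ p + length l → FirstRowHook p l t
firstRowHook-beyond {p} {j} {t} l l≤j t>0 sum = j , below-by t>0 t+j≡p , hook≡t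
  where
  open ≡-Reasoning
  t+j≡p : t + j ≡ p
  t+j≡p = +-cancelʳ-≡ (length l) _ _ (trans (+-assoc t j (length l)) sum)
  hook≡t : (p ∸ j) + colLen l j ≡ t
  hook≡t = begin
    (p ∸ j) + colLen l j   ≡⟨ cong ((p ∸ j) +_) (colLen-empty l≤j) ⟩
    (p ∸ j) + 0            ≡⟨ +-identityʳ (p ∸ j) ⟩
    p ∸ j                  ≡⟨ cong (_∸ j) (sym t+j≡p) ⟩
    t + j ∸ j              ≡⟨ m+n∸n≡m t j ⟩
    t                      ∎

firstRowHook⇒gap : ∀ {p l t} → Strict (p ∷ l) → FirstRowHook p l t → FirstRowGap p l t
firstRowHook⇒gap {l = []} _ (j , j<p , h≡t) = firstRowGap-beyond [] j<p [] h≡t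
firstRowHook⇒gap {p} {q ∷ l} {t} sp (j , j<p , h≡t) with j <? q
... | no j≮q = firstRowGap-beyond (q ∷ l) j<p (parts-≤ (strict-tail sp) (≮⇒≥ j≮q)) h≡t
... | yes j<q with firstRowHook⇒gap (strict-tail sp) (j , j<q , refl)
...   | t′>0 , d , t′+d≡ , d∉ = t>0 , d , sum , ∉-∷ (<⇒≢ (below-by t′>0 t′+d≡)) d∉
  where
  c : ℕ
  c = colLen l j
  hook≡t : (p ∸ j) + suc c ≡ t
  hook≡t = trans (cong ((p ∸ j) +_) (sym (colLen-∷ l j<q))) h≡t
  t>0 : 0 < t
  t>0 = subst (0 <_) hook≡t (≤-trans (s≤s z≤n) (m≤n+m (suc c) (p ∸ j)))
  sum : t + d ≡ p + suc (length l)
  sum = trans (cong (_+ d) (sym hook≡t)) (shift-row c d (length l) (<⇒≤ j<q) (<⇒≤ j<p) t′+d≡)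

firstRowGap⇒hook : ∀ {p l t} → Strict (p ∷ l) → FirstRowGap p l t → FirstRowHook p l t
firstRowGap⇒hook {p} {[]} {t} _ (t>0 , d , t+d≡ , _) = firstRowHook-beyond [] [] t>0 (trans (cong (t +_) (+-identityʳ d)) t+d≡)
firstRowGap⇒hook {p} {q ∷ l} {t} sp (t>0 , d , t+d≡ , d∉) with <-cmp d (q + length l)
... | tri≈ _ d≡ _ = ⊥-elim (d∉ (here d≡))
... | tri> _ _ d> = firstRowHook-beyond (q ∷ l) (parts-≤ (strict-tail sp) q≤j) t>0
                      (trans (cong (t +_) (m∸n+n≡m ℓ<d)) t+d≡)
  where
  ℓ<d : suc (length l) ≤ d
  ℓ<d = ≤-trans (s≤s (m≤n+m (length l) q)) d>
  q≤j : q ≤ d ∸ suc (length l)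
  q≤j = m+n≤o⇒m≤o∸n q (subst (_≤ d) (sym (+-suc q (length l))) d>)
... | tri< d< _ _ with firstRowGap⇒hook (strict-tail sp) (m<n⇒0<n∸m d< , d , m∸n+n≡m (<⇒≤ d<) , d∉ ∘ there)
...   | j , j<q , h≡t′ = j , j<p , hook≡t
  where
  open ≡-Reasoning
  c : ℕ
  c = colLen l j
  j<p : j < p
  j<p = <-trans j<q (Linked.head (proj₂ sp))
  hook≡t : (p ∸ j) + colLen (q ∷ l) j ≡ t
  hook≡t = begin
    (p ∸ j) + colLen (q ∷ l) j   ≡⟨ cong ((p ∸ j) +_) (colLen-∷ l j<q) ⟩
    (p ∸ j) + suc c              ≡⟨ +-cancelʳ-≡ d _ _ (trans (shift-row c d (length l) (<⇒≤ j<q) (<⇒≤ j<p)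
                                      (trans (cong (_+ d) h≡t′) (m∸n+n≡m (<⇒≤ d<)))) (sym t+d≡)) ⟩
    t                            ∎

BetaHook : List ℕ → ℕ → Set
BetaHook X t = ∃[ x ] ∃[ d ] x ∈ X × t + d ≡ x × d ∉ X

hook⇒betaHook : ∀ {l t} → Strict l → HasHook l t → BetaHook (β l) t
hook⇒betaHook {[]} _ (_ , _ , () , _)
hook⇒betaHook {p ∷ l} {t} sp h with Equivalence.to (hook-∷⇔ (strict-below sp)) h
... | inj₁ h′ with hook⇒betaHook (strict-tail sp) h′
...   | x , d , x∈ , t+d≡x , d∉ = x , d , there x∈ , t+d≡x , ∉-∷ (<⇒≢ d<p+ℓ) d∉
  where
  d<p+ℓ : d < p + length l
  d<p+ℓ = ≤-<-trans (subst (d ≤_) t+d≡x (m≤n+m d t)) (All.lookup (β-bounded l (strict-below sp)) x∈)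
hook⇒betaHook {p ∷ l} sp h | inj₂ fr with firstRowHook⇒gap sp fr
... | t>0 , d , t+d≡ , d∉ = p + length l , d , here refl , t+d≡ , ∉-∷ (<⇒≢ (below-by t>0 t+d≡)) d∉

betaHook⇒hook : ∀ {l t} → 0 < t → Strict l → BetaHook (β l) t → HasHook l t
betaHook⇒hook {[]} _ _ (_ , _ , () , _)
betaHook⇒hook {p ∷ l} t>0 sp (x , d , here refl , t+d≡x , d∉) =
  Equivalence.from (hook-∷⇔ (strict-below sp)) (inj₂ (firstRowGap⇒hook sp (t>0 , d , t+d≡x , d∉ ∘ there)))
betaHook⇒hook {p ∷ l} t>0 sp (x , d , there x∈ , t+d≡x , d∉) =
  Equivalence.from (hook-∷⇔ (strict-below sp)) (inj₁ (betaHook⇒hook t>0 (strict-tail sp) (x , d , x∈ , t+d≡x , d∉ ∘ there)))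

StepClosed : ℕ → List ℕ → Set
StepClosed t X = ∀ {x d} → x ∈ X → t + d ≡ x → d ∈ X

core⇔closed : ∀ {t l} → 0 < t → Strict l → IsCore t l ⇔ StepClosed t (β l)
core⇔closed {t} {l} t>0 sp = mk⇔ core⇒closed closed⇒core
  where
  core⇒closed : IsCore t l → StepClosed t (β l)
  core⇒closed core {x} {d} x∈ t+d≡x with d ∈? β l
  ... | yes d∈ = d∈
  ... | no d∉ = ⊥-elim (core (betaHook⇒hook t>0 sp (x , d , x∈ , t+d≡x , d∉)))
  closed⇒core : StepClosed t (β l) → IsCore t l
  closed⇒core closed h with hook⇒betaHook sp h
  ... | x , d , x∈ , t+d≡x , d∉ = d∉ (closed x∈ t+d≡x)

descend : ∀ {t X} → StepClosed t X → ∀ {r q q′} → q′ ≤ q → r + q * t ∈ X → r + q′ * t ∈ X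
descend closed {q = zero} z≤n x∈ = x∈
descend {t} closed {r} {suc q} q′≤ x∈ with m≤n⇒m<n∨m≡n q′≤
... | inj₂ refl = x∈
... | inj₁ (s≤s q′≤q) = descend closed q′≤q (closed x∈ (step r q t))
  where
  step : ∀ r q t → t + (r + q * t) ≡ r + suc q * t
  step = solve-∀

-- Abacus words: entries at most m and no two adjacent nonzero entries (entries past the end read 0).
Admissible : ℕ → List ℕ → Set
Admissible m c = (∀ i → part c i ≤ m) × (∀ i → part c i ≡ 0 ⊎ part c (suc i) ≡ 0)

Word : ℕ → ℕ → List ℕ → Set
Word m k c = Admissible m c × length c ≡ k

part-beyond : ∀ {c i} → length c ≤ i → part c i ≡ 0
part-beyond {[]} _ = refl
part-beyond {_ ∷ c} {suc i} (s≤s ℓ≤i) = part-beyond {c} ℓ≤i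

part-applyUpTo : ∀ (f : ℕ → ℕ) {n i} → i < n → part (applyUpTo f n) i ≡ f i
part-applyUpTo f {suc n} {zero} _ = refl
part-applyUpTo f {suc n} {suc i} (s≤s i<n) = part-applyUpTo (f ∘ suc) i<n

part-ext : ∀ {c c′} → length c ≡ length c′ → (∀ {i} → i < length c → part c i ≡ part c′ i) → c ≡ c′
part-ext {[]} {[]} _ _ = refl
part-ext {x ∷ c} {y ∷ c′} ℓ≡ same = cong₂ _∷_ (same (s≤s z≤n)) (part-ext (suc-injective ℓ≡) (same ∘ s≤s))

-- The abacus with s = k + 1 runners: x = r + q·s sits on runner r at level q.
module Abacus (m k : ℕ) where

  s : ℕ
  s = suc k

  digits : ∀ x → x ≡ x % s + (x / s) * s
  digits x = m≡m%n+[m/n]*n x s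

  <-digits : ∀ {r q r′ q′} → r < s → q < q′ → r + q * s < r′ + q′ * s
  <-digits {r} {q} {r′} r<s q<q′ = <-≤-trans (+-monoˡ-< (q * s) r<s) (≤-trans (*-monoˡ-≤ s q<q′) (m≤n+m _ r′))

  digits-unique : ∀ {r q r′ q′} → r < s → r′ < s → r + q * s ≡ r′ + q′ * s → r ≡ r′ × q ≡ q′
  digits-unique {r} {q} {r′} {q′} r<s r′<s e with <-cmp q q′
  ... | tri≈ _ refl _ = +-cancelʳ-≡ (q * s) r r′ e , refl
  ... | tri< q<q′ _ _ = ⊥-elim (<-irrefl e (<-digits r<s q<q′))
  ... | tri> _ _ q′<q = ⊥-elim (<-irrefl (sym e) (<-digits r′<s q′<q))

  digits-bound : ∀ {r q} → r < s → q < m → r + q * s < m * s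
  digits-bound {r} {q} r<s q<m = <-≤-trans (+-monoˡ-< (q * s) r<s) (*-monoˡ-≤ s q<m)

  -- The beads of a word c: on each runner r = 1, …, k the first c_r levels, where c_r = part c (r - 1).
  IsBead : List ℕ → ℕ → Set
  IsBead c x = (x % s ≢ 0) × (x / s < part c (x % s ∸ 1))

  isBead? : ∀ c x → Dec (IsBead c x)
  isBead? c x = ¬? (x % s ≟ 0) ×-dec (x / s <? part c (x % s ∸ 1))

  beads : List ℕ → List ℕ
  beads c = filter (isBead? c) (downFrom (m * s))

  BeadAt : List ℕ → ℕ → Set
  BeadAt c x = ∃[ r ] ∃[ q ] x ≡ r + q * s × 0 < r × r < s × q < part c (r ∸ 1)

  bead-position : ∀ c {x} → x ∈ beads c → BeadAt c x
  bead-position c {x} x∈ with ∈-filter⁻ (isBead? c) {xs = downFrom (m * s)} x∈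
  ... | _ , r≢0 , q<c = x % s , x / s , digits x , n≢0⇒n>0 r≢0 , m%n<n x s , q<c

  beads-bound : ∀ c {x} → x ∈ beads c → x < m * s
  beads-bound c x∈ = ∈-downFrom⁻ (proj₁ (∈-filter⁻ (isBead? c) {xs = downFrom (m * s)} x∈))

  position-bead : ∀ c {r q} → 0 < r → r < s → q < part c (r ∸ 1) → r + q * s < m * s → r + q * s ∈ beads c
  position-bead c {r} {q} r>0 r<s q<c bound with digits-unique (m%n<n (r + q * s) s) r<s (sym (digits (r + q * s)))
  ... | r≡ , q≡ = ∈-filter⁺ (isBead? c) (∈-downFrom⁺ bound)
                    ( (λ r≡0 → <⇒≢ r>0 (sym (trans (sym r≡) r≡0)))
                    , subst₂ (λ a b → b < part c (a ∸ 1)) (sym r≡) (sym q≡) q<c)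

  beads-positive : ∀ c → All (0 <_) (beads c)
  beads-positive c = All.tabulate positive
    where
    positive : ∀ {x} → x ∈ beads c → 0 < x
    positive x∈ with bead-position c x∈
    ... | r , q , refl , r>0 , _ = <-≤-trans r>0 (m≤m+n r (q * s))

  beads-decreasing : ∀ c → Linked _>_ (beads c)
  beads-decreasing c = Linked.filter⁺ (isBead? c) >-trans (Linked.applyDownFrom⁺₂ (λ i → i) (m * s) n<1+n)

  -- Neighbouring runners are never both occupied, and a bead on the last runner k is followed by
  -- runner 0 of the next level, which is empty; so beads are never consecutive.
  beads-nonConsecutive : ∀ c → Admissible m c → NonConsecutive (beads c)
  beads-nonConsecutive c (_ , apart) a∈ sa∈ with bead-position c a∈ | bead-position c sa∈
  ... | r , q , refl , r>0 , r<s , q<c | r′ , q′ , e , r′>0 , r′<s , q′<c with suc r <? s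
  ...   | yes sr<s with digits-unique {suc r} {q} {r′} {q′} sr<s r′<s e
  ...     | refl , refl = neighbours r>0 q<c q′<c
    where
    neighbours : ∀ {r q} → 0 < r → q < part c (r ∸ 1) → q < part c r → ⊥
    neighbours {suc r} _ q<c₁ q<c₂ with apart r
    ... | inj₁ c₁≡0 = n≮0 (subst (_ <_) c₁≡0 q<c₁)
    ... | inj₂ c₂≡0 = n≮0 (subst (_ <_) c₂≡0 q<c₂)
  beads-nonConsecutive _ _ _ _ | r , q , refl , r>0 , r<s , q<c | r′ , q′ , e , r′>0 , r′<s , q′<c | no sr≮s =
    <⇒≢ r′>0 (proj₁ (digits-unique {0} {suc q} {r′} {q′} (s≤s z≤n) r′<s (trans (cong (_+ q * s) (sym sr≡s)) e)))
    where
    sr≡s : suc r ≡ s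
    sr≡s = ≤-antisym r<s (≮⇒≥ sr≮s)

  beads-sparse : ∀ c → Admissible m c → Sparse (beads c)
  beads-sparse c adm = decreasing⇒sparse (beads-positive c) (beads-decreasing c) (beads-nonConsecutive c adm)

  beads-closed-s : ∀ c → StepClosed s (beads c)
  beads-closed-s c {x} {d} x∈ s+d≡x with bead-position c x∈
  ... | r , zero , refl , _ , r<s , _ = ⊥-elim (<⇒≱ r<s (≤-trans (m≤m+n s d) (≤-reflexive (trans s+d≡x (+-identityʳ r)))))
  ... | r , suc q , refl , r>0 , r<s , q<c =
    subst (_∈ beads c) (sym d≡) (position-bead c r>0 r<s (<-trans (n<1+n q) q<c)
      (subst (_< m * s) d≡ (<-trans (below-by (s≤s z≤n) s+d≡x) (beads-bound c x∈))))
    where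
    d≡ : d ≡ r + q * s
    d≡ = +-cancelˡ-≡ s d (r + q * s) (trans s+d≡x (shift r q s))
      where
      shift : ∀ r q s → r + suc q * s ≡ s + (r + q * s)
      shift = solve-∀

  -- All beads lie below m·s, so closure under m·s + 1 holds vacuously.
  beads-closed-top : ∀ c → StepClosed (m * s + 1) (beads c)
  beads-closed-top c {x} {d} x∈ e =
    ⊥-elim (<⇒≱ (beads-bound c x∈) (≤-trans (m≤m+n (m * s) (1 + d)) (≤-reflexive (trans (sym (+-assoc (m * s) 1 d)) e))))

  run : List ℕ → ℕ → ℕ → ℕ → ℕ
  run X r zero q = q
  run X r (suc n) q with r + q * s ∈? X
  ... | yes _ = run X r n (suc q)
  ... | no _ = q

  run-filled : ∀ X r n {q₀ q} → q₀ ≤ q → q < run X r n q₀ → r + q * s ∈ X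
  run-filled X r zero q₀≤q q<run = ⊥-elim (<⇒≱ q<run q₀≤q)
  run-filled X r (suc n) {q₀} q₀≤q q<run with r + q₀ * s ∈? X
  ... | no _ = ⊥-elim (<⇒≱ q<run q₀≤q)
  ... | yes q₀∈ with m≤n⇒m<n∨m≡n q₀≤q
  ...   | inj₂ refl = q₀∈
  ...   | inj₁ q₀<q = run-filled X r n q₀<q q<run

  run-bounded : ∀ X r n q₀ → run X r n q₀ ≤ q₀ + n
  run-bounded X r zero q₀ = ≤-reflexive (sym (+-identityʳ q₀))
  run-bounded X r (suc n) q₀ with r + q₀ * s ∈? X
  ... | no _ = m≤m+n q₀ (suc n)
  ... | yes _ = ≤-trans (run-bounded X r n (suc q₀)) (≤-reflexive (sym (+-suc q₀ n)))

  run-stops : ∀ X r n q₀ → run X r n q₀ < q₀ + n → r + run X r n q₀ * s ∉ X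
  run-stops X r zero q₀ run< = ⊥-elim (<-irrefl (sym (+-identityʳ q₀)) run<)
  run-stops X r (suc n) q₀ run< with r + q₀ * s ∈? X
  ... | no q₀∉ = q₀∉
  ... | yes _ = run-stops X r n (suc q₀) (<-≤-trans run< (≤-reflexive (+-suc q₀ n)))

  runLength : List ℕ → ℕ → ℕ
  runLength X r = run X r m 0

  readWord : List ℕ → List ℕ
  readWord X = applyUpTo (λ i → runLength X (suc i)) k

  part-readWord : ∀ X {i} → i < k → part (readWord X) i ≡ runLength X (suc i)
  part-readWord X = part-applyUpTo (λ i → runLength X (suc i))

  readWord-beyond : ∀ X {i} → k ≤ i → part (readWord X) i ≡ 0
  readWord-beyond X k≤i = part-beyond {readWord X} (subst (_≤ _) (sym (length-applyUpTo _ k)) k≤i)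

  module Decode (X : List ℕ) (sparse : Sparse X) (closed-s : StepClosed s X) (closed-top : StepClosed (m * s + 1) X) where

    runLength≤m : ∀ r → runLength X r ≤ m
    runLength≤m r = run-bounded X r m 0

    filled : ∀ {r q} → q < runLength X r → r + q * s ∈ X
    filled {r} = run-filled X r m z≤n

    ground : ∀ r q → r + q * s ∈ X → r ∈ X
    ground r q x∈ = subst (_∈ X) (+-identityʳ r) (descend closed-s {r} {q} z≤n x∈)

    -- Run lengths are at most m, and two neighbouring runners cannot both be occupied at level 0.
    readWord-admissible : Admissible m (readWord X)
    readWord-admissible = bounded , apart
      where
      bounded : ∀ i → part (readWord X) i ≤ m
      bounded i with i <? k
      ... | yes i<k = subst (_≤ m) (sym (part-readWord X i<k)) (runLength≤m (suc i))
      ... | no i≮k = subst (_≤ m) (sym (readWord-beyond X (≮⇒≥ i≮k))) z≤n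
      bottom : ∀ r → runLength X r ≢ 0 → r ∈ X
      bottom r len≢0 = subst (_∈ X) (+-identityʳ r) (filled {r} {0} (n≢0⇒n>0 len≢0))
      apart-runners : ∀ r → runLength X r ≡ 0 ⊎ runLength X (suc r) ≡ 0
      apart-runners r with runLength X r ≟ 0 | runLength X (suc r) ≟ 0
      ... | yes len≡0 | _ = inj₁ len≡0
      ... | no _ | yes len′≡0 = inj₂ len′≡0
      ... | no len≢0 | no len′≢0 = ⊥-elim (gapped⇒nonConsecutive (proj₂ sparse)
                                      (bottom r len≢0) (bottom (suc r) len′≢0))
      apart : ∀ i → part (readWord X) i ≡ 0 ⊎ part (readWord X) (suc i) ≡ 0
      apart i with suc i <? k
      ... | no si≮k = inj₂ (readWord-beyond X (≮⇒≥ si≮k))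
      ... | yes si<k rewrite part-readWord X (<-trans (n<1+n i) si<k) | part-readWord X si<k = apart-runners (suc i)

    -- On runner r + 1 the occupied levels are exactly those below its run length: the position just
    -- above the run is empty, either by the definition of the run or, for a full run of m levels,
    -- because stepping down by m·s + 1 would make runners r and r + 1 both occupied.
    below-runLength : ∀ {r q} → suc r + q * s ∈ X → q < runLength X (suc r)
    below-runLength {r} {q} x∈ with q <? runLength X (suc r)
    ... | yes q<len = q<len
    ... | no q≮len = ⊥-elim (top-empty (descend closed-s {suc r} {q} (≮⇒≥ q≮len) x∈))
      where
      top-empty : suc r + runLength X (suc r) * s ∈ X → ⊥
      top-empty top∈ with m≤n⇒m<n∨m≡n (runLength≤m (suc r))
      ... | inj₁ len<m = run-stops X (suc r) m 0 len<m top∈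
      ... | inj₂ len≡m = gapped⇒nonConsecutive (proj₂ sparse) (closed-top top∈ step) (ground (suc r) q x∈)
        where
        shuffle : ∀ m s r → m * s + 1 + r ≡ suc r + m * s
        shuffle = solve-∀
        step : m * s + 1 + r ≡ suc r + runLength X (suc r) * s
        step = trans (shuffle m s r) (cong (λ l → suc r + l * s) (sym len≡m))

    X≡beads : X ≡ beads (readWord X)
    X≡beads = strict-ext (Linked.map (<-trans (n<1+n _)) (proj₂ sparse)) (beads-decreasing (readWord X)) (mk⇔ to from)
      where
      on-runner : ∀ {r q} → r < s → r + q * s ∈ X → r + q * s ∈ beads (readWord X)
      on-runner {zero} {q} _ x∈ = ⊥-elim (<-irrefl refl (All.lookup (proj₁ sparse) (ground 0 q x∈)))
      on-runner {suc r} {q} r<s x∈ =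
        position-bead (readWord X) (s≤s z≤n) r<s q<part (digits-bound r<s (<-≤-trans q<len (runLength≤m (suc r))))
        where
        q<len : q < runLength X (suc r)
        q<len = below-runLength x∈
        q<part : q < part (readWord X) r
        q<part = subst (q <_) (sym (part-readWord X (≤-pred r<s))) q<len
      to : ∀ {x} → x ∈ X → x ∈ beads (readWord X)
      to {x} x∈ = subst (_∈ beads (readWord X)) (sym (digits x)) (on-runner {x % s} {x / s} (m%n<n x s) (subst (_∈ X) (digits x) x∈))
      from : ∀ {x} → x ∈ beads (readWord X) → x ∈ X
      from x∈ with bead-position (readWord X) x∈
      ... | suc r , q , refl , _ , s≤s r<k , q<part = filled (subst (q <_) (part-readWord X r<k) q<part)

  -- An admissible word is recovered from its beads: if c_i > c′_i, the bead of c on runner i + 1 at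
  -- level c′_i would be missing from the beads of c′.
  entry-≤ : ∀ c c′ → Admissible m c → (∀ {x} → x ∈ beads c → x ∈ beads c′) → ∀ {i} → i < k → part c i ≤ part c′ i
  entry-≤ c c′ (bounded , _) sub {i} i<k with part c′ i <? part c i
  ... | no c′≮c = ≮⇒≥ c′≮c
  ... | yes c′<c with bead-position c′ (sub (position-bead c (s≤s z≤n) (s≤s i<k) c′<c
                         (digits-bound (s≤s i<k) (<-≤-trans c′<c (bounded i)))))
  ...   | r , q , e , _ , r<s , q<c′ with digits-unique {suc i} {part c′ i} {r} {q} (s≤s i<k) r<s e
  ...     | refl , refl = ⊥-elim (<-irrefl refl q<c′)

  beads-injective : ∀ {c c′} → Word m k c → Word m k c′ → beads c ≡ beads c′ → c ≡ c′
  beads-injective {c} {c′} (adm , ℓ≡k) (adm′ , ℓ′≡k) same = part-ext (trans ℓ≡k (sym ℓ′≡k)) entries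
    where
    entries : ∀ {i} → i < length c → part c i ≡ part c′ i
    entries {i} i<ℓ = ≤-antisym (entry-≤ c c′ adm (subst (_ ∈_) same) i<k) (entry-≤ c′ c adm′ (subst (_ ∈_) (sym same)) i<k)
      where
      i<k : i < k
      i<k = subst (_ <_) ℓ≡k i<ℓ

  partitionOf : List ℕ → List ℕ
  partitionOf c = β⁻¹ (beads c)

  partitionOf-injective : ∀ {c c′} → Word m k c → Word m k c′ → partitionOf c ≡ partitionOf c′ → c ≡ c′
  partitionOf-injective {c} {c′} w w′ same = beads-injective w w′ (begin
    beads c                 ≡⟨ sym (β-β⁻¹ (beads-sparse c (proj₁ w))) ⟩
    β (partitionOf c)       ≡⟨ cong β same ⟩
    β (partitionOf c′)      ≡⟨ β-β⁻¹ (beads-sparse c′ (proj₁ w′)) ⟩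
    beads c′                ∎)
    where open ≡-Reasoning

  s>0 : 0 < s
  s>0 = s≤s z≤n

  top>0 : 0 < m * s + 1
  top>0 = m≤n+m 1 (m * s)

  partitionOf-core : ∀ c → Admissible m c → DistinctCore m s (partitionOf c)
  partitionOf-core c adm = proj₁ distinct , proj₂ distinct
                         , Equivalence.from (core⇔closed s>0 strict) (closed (beads-closed-s c))
                         , Equivalence.from (core⇔closed top>0 strict) (closed (beads-closed-top c))
    where
    sparse : Sparse (beads c)
    sparse = beads-sparse c adm
    strict : Strict (partitionOf c)
    strict = β⁻¹-strict sparse
    distinct : IsPartition (partitionOf c) × DistinctParts (partitionOf c)
    distinct = strict⇒distinct strict
    closed : ∀ {t} → StepClosed t (beads c) → StepClosed t (β (partitionOf c))
    closed {t} = subst (StepClosed t) (sym (β-β⁻¹ sparse))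

  core-partitionOf : ∀ {μ} → DistinctCore m s μ → ∃[ c ] Word m k c × μ ≡ partitionOf c
  core-partitionOf {μ} (isPartition , distinct , s-core , top-core) =
    readWord X , (Decode.readWord-admissible X sparse closed-s closed-top , length-applyUpTo _ k)
               , trans (sym (β⁻¹-β μ)) (cong β⁻¹ (Decode.X≡beads X sparse closed-s closed-top))
    where
    strict : Strict μ
    strict = distinct⇒strict isPartition distinct
    X : List ℕ
    X = β μ
    sparse : Sparse X
    sparse = β-sparse strict
    closed-s : StepClosed s X
    closed-s = Equivalence.to (core⇔closed s>0 strict) s-core
    closed-top : StepClosed (m * s + 1) X
    closed-top = Equivalence.to (core⇔closed top>0 strict) top-core

length-cartesianProductWith : ∀ {A B C : Set} (f : A → B → C) xs ys →
                              length (cartesianProductWith f xs ys) ≡ length xs * length ys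
length-cartesianProductWith f [] ys = refl
length-cartesianProductWith f (x ∷ xs) ys =
  trans (length-++ (map (f x) ys)) (cong₂ _+_ (length-map (f x) ys) (length-cartesianProductWith f xs ys))

-- The number of admissible words of length k; it is E_m(k + 1).
count : ℕ → ℕ → ℕ
count m zero = 1
count m (suc zero) = suc m
count m (suc (suc n)) = count m (suc n) + m * count m n

-- The admissible words of length n, listed by their first entry: either 0, or a + 1 ≤ m followed by 0.
module Words (m : ℕ) where

  startPair : ℕ → List ℕ → List ℕ
  startPair a c = suc a ∷ 0 ∷ c

  words : ℕ → List (List ℕ)
  words zero = [] ∷ []
  words (suc zero) = map (_∷ []) (upTo (suc m))
  words (suc (suc n)) = map (0 ∷_) (words (suc n)) ++ cartesianProductWith startPair (upTo m) (words n)

  length-words : ∀ n → length (words n) ≡ count m n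
  length-words zero = refl
  length-words (suc zero) = trans (length-map _ (upTo (suc m))) (length-upTo (suc m))
  length-words (suc (suc n)) = trans (length-++ (map (0 ∷_) (words (suc n))))
    (cong₂ _+_ (trans (length-map _ (words (suc n))) (length-words (suc n)))
               (trans (length-cartesianProductWith startPair (upTo m) (words n)) (cong₂ _*_ (length-upTo m) (length-words n))))

  words-unique : ∀ n → Unique (words n)
  words-unique zero = [] ∷ []
  words-unique (suc zero) = Unique.map⁺ (λ { refl → refl }) (Unique.upTo⁺ (suc m))
  words-unique (suc (suc n)) = Unique.++⁺ (Unique.map⁺ (λ { refl → refl }) (words-unique (suc n)))
    (Unique.cartesianProductWith⁺ startPair (λ { refl → refl , refl }) (Unique.upTo⁺ m) (words-unique n)) disjoint
    where
    disjoint : ∀ {c} → ¬ (c ∈ map (0 ∷_) (words (suc n)) × c ∈ cartesianProductWith startPair (upTo m) (words n))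
    disjoint (c∈₁ , c∈₂) with ∈-map⁻ (0 ∷_) c∈₁ | ∈-cartesianProductWith⁻ startPair (upTo m) (words n) c∈₂
    ... | _ , _ , refl | _ , _ , _ , _ , ()

  admissible-[] : Admissible m []
  admissible-[] = (λ _ → z≤n) , (λ _ → inj₁ refl)

  admissible-0∷ : ∀ {c} → Admissible m c → Admissible m (0 ∷ c)
  admissible-0∷ {c} (bounded , apart) = bounded′ , apart′
    where
    bounded′ : ∀ i → part (0 ∷ c) i ≤ m
    bounded′ zero = z≤n
    bounded′ (suc i) = bounded i
    apart′ : ∀ i → part (0 ∷ c) i ≡ 0 ⊎ part (0 ∷ c) (suc i) ≡ 0
    apart′ zero = inj₁ refl
    apart′ (suc i) = apart i

  admissible-startPair : ∀ {a c} → a < m → Admissible m c → Admissible m (startPair a c)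
  admissible-startPair {a} {c} a<m (bounded , apart) = bounded′ , apart′
    where
    bounded′ : ∀ i → part (startPair a c) i ≤ m
    bounded′ zero = a<m
    bounded′ (suc zero) = z≤n
    bounded′ (suc (suc i)) = bounded i
    apart′ : ∀ i → part (startPair a c) i ≡ 0 ⊎ part (startPair a c) (suc i) ≡ 0
    apart′ zero = inj₂ refl
    apart′ (suc zero) = inj₁ refl
    apart′ (suc (suc i)) = apart i

  admissible-tail : ∀ {x c} → Admissible m (x ∷ c) → Admissible m c
  admissible-tail (bounded , apart) = bounded ∘ suc , apart ∘ suc

  words-sound : ∀ n {c} → c ∈ words n → Word m n c
  words-sound zero (here refl) = admissible-[] , refl
  words-sound (suc zero) c∈ with ∈-map⁻ (_∷ []) c∈
  ... | a , a∈ , refl = (bounded , (λ _ → inj₂ refl)) , refl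
    where
    bounded : ∀ i → part (a ∷ []) i ≤ m
    bounded zero = ≤-pred (∈-upTo⁻ a∈)
    bounded (suc i) = z≤n
  words-sound (suc (suc n)) c∈ with ∈-++⁻ (map (0 ∷_) (words (suc n))) c∈
  ... | inj₁ c∈₁ with ∈-map⁻ (0 ∷_) c∈₁
  ...   | c′ , c′∈ , refl with words-sound (suc n) c′∈
  ...     | adm , ℓ≡ = admissible-0∷ adm , cong suc ℓ≡
  words-sound (suc (suc n)) c∈ | inj₂ c∈₂ with ∈-cartesianProductWith⁻ startPair (upTo m) (words n) c∈₂
  ... | a , c′ , a∈ , c′∈ , refl with words-sound n c′∈
  ...   | adm , ℓ≡ = admissible-startPair (∈-upTo⁻ a∈) adm , cong (suc ∘ suc) ℓ≡

  words-complete : ∀ n c → Word m n c → c ∈ words n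
  words-complete zero [] _ = here refl
  words-complete (suc zero) (a ∷ []) ((bounded , _) , _) = ∈-map⁺ (_∷ []) (∈-upTo⁺ (s≤s (bounded 0)))
  words-complete (suc (suc n)) (zero ∷ c) (adm , ℓ≡) =
    ∈-++⁺ˡ (∈-map⁺ (0 ∷_) (words-complete (suc n) c (admissible-tail adm , suc-injective ℓ≡)))
  words-complete (suc (suc n)) (suc a ∷ b ∷ c) (adm@(bounded , apart) , ℓ≡) with apart 0
  ... | inj₁ ()
  ... | inj₂ refl = ∈-++⁺ʳ (map (0 ∷_) (words (suc n)))
        (∈-cartesianProductWith⁺ startPair (∈-upTo⁺ (bounded 0))
          (words-complete n c (admissible-tail (admissible-tail adm) , suc-injective (suc-injective ℓ≡))))

distinctCore-count : ∀ m k → Counts (DistinctCore m (suc k)) (count m k)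
distinctCore-count m k = map partitionOf (words k) , unique , members , trans (length-map partitionOf (words k)) (length-words k)
  where
  open Abacus m k using (partitionOf; partitionOf-injective; partitionOf-core; core-partitionOf)
  open Words m using (words; words-unique; words-sound; words-complete; length-words)
  unique : Unique (map partitionOf (words k))
  unique = map-unique partitionOf (words-unique k) (λ c∈ c′∈ → partitionOf-injective (words-sound k c∈) (words-sound k c′∈))
  members : ∀ μ → (μ ∈ map partitionOf (words k)) ⇔ DistinctCore m (suc k) μ
  members μ = mk⇔ to from
    where
    to : μ ∈ map partitionOf (words k) → DistinctCore m (suc k) μ
    to μ∈ with ∈-map⁻ partitionOf μ∈
    ... | c , c∈ , refl = partitionOf-core c (proj₁ (words-sound k c∈))
    from : DistinctCore m (suc k) μ → μ ∈ map partitionOf (words k)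
    from core with core-partitionOf core
    ... | c , w , refl = ∈-map⁺ partitionOf (words-complete k c w)

theorem1p14 : (m : ℕ) → m ≥ 1 →
    Counts (DistinctCore m 1) 1
    × Counts (DistinctCore m 2) (m + 1)
    × (∀ (s a b : ℕ) → s ≥ 3 →
         Counts (DistinctCore m (s ∸ 1)) a →
         Counts (DistinctCore m (s ∸ 2)) b →
         Counts (DistinctCore m s) (a + m * b))
theorem1p14 m _ = distinctCore-count m 0 , subst (Counts (DistinctCore m 2)) (+-comm 1 m) (distinctCore-count m 1) , recursion
  where
  -- Any counts of the two previous cases agree with count m, whose defining recursion is the claim.
  recursion : ∀ (s a b : ℕ) → s ≥ 3 → Counts (DistinctCore m (s ∸ 1)) a → Counts (DistinctCore m (s ∸ 2)) b →
              Counts (DistinctCore m s) (a + m * b)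
  recursion (suc (suc (suc n))) a b (s≤s (s≤s (s≤s _))) counted-a counted-b =
    subst (Counts (DistinctCore m (3 + n)))
      (cong₂ (λ x y → x + m * y) (counts-unique (distinctCore-count m (suc n)) counted-a)
                                  (counts-unique (distinctCore-count m n) counted-b))
      (distinctCore-count m (2 + n))
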